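{- Let $G$ be a nice graph with $V_4$ the set of its vertices of degree at least $4$, let $\mathcal{Q}$ be a covering family in $(G,V_4)$, let $\ell\in\mathbb{N}$, and let $(\mathcal{T},d)$ be a $(G,V_4,\ell)$-pattern encoding $\mathcal{Q}$. Then $\mathrm{odd}(G-\mathcal{Q})=\mathrm{odd}(G)+\mathrm{odd}(\mathcal{T},d)$.
   Context: All graphs are finite, simple and undirected; subcubic means maximum degree at most $3$. $\mathrm{odd}(H)$ is the number of odd-degree vertices of $H$; $G-\mathcal{Q}$ is obtained from $G$ by deleting all edges of paths in $\mathcal{Q}$. A cycle $C$ in $G$ is a pan cycle if exactly one vertex of $C$ has degree $3$ in $G$ and all others degree $2$; a bull cycle if exactly two have degree $3$ and all others degree $2$. $G$ is nice if it is connected, not subcubic, has no pan cycles, and every bull cycle has length $3$. $N_G(S)$, $N_G[S]$ are open/closed neighborhoods. Covering family: a family $\mathcal{Q}$ of pairwise edge-disjoint paths such that every edge incident to $V_4$ lies on some path of $\mathcal{Q}$. Terminal collection for $\mathcal{Q}$: $U\subseteq V(G)$ with $N_G[V_4]\subseteq U$, containing both endpoints of every path of $\mathcal{Q}$, and such that for all $u,v\in U$, if two distinct paths of $\mathcal{Q}$ both visit $u$ and $v$, then at least one visits another vertex of $U$ between $u$ and $v$. $X_\ell=\{x_1,\dots,x_\ell\}$ are formal variables disjoint from $V(G)$. A $(G,V_4,\ell)$-trace is a finite sequence over $N_G[V_4]\cup X_\ell$ with no repeated symbol and no variable consecutive to a vertex of $V_4$. For a trace $T=(t_1,\dots,t_r)$: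 $\mathsf{edges}(T)$ = unordered consecutive pairs $t_it_{i+1}$ containing a symbol of $V_4$; $\mathsf{ends}(T)$ = the other consecutive pairs; $\deg_T(y)$ is $0$ if $y$ is not on $T$, $1$ if $y\in\{t_1,t_r\}$, $2$ otherwise. A $(G,V_4,\ell)$-pattern is $(\mathcal{T},d)$, $\mathcal{T}$ a collection of traces, $d:X_\ell\to\{1,2,3\}$, with: distinct traces have disjoint $\mathsf{ends}$ and disjoint $\mathsf{edges}$ sets; $\bigcup_T\mathsf{edges}(T)$ equals the set of edges incident to $V_4$; $\sum_T\deg_T(x_i)\le d(x_i)$ for all $x_i$; $\sum_T\deg_T(v)\le\deg_G(v)$ for all $v\in N_G(V_4)$. Encoding: $(\mathcal{T},d)$ encodes $\mathcal{Q}$ if for some terminal collection $U$ of $\mathcal{Q}$, $V_X=U\setminus N_G[V_4]$, $\ell=|V_X|$, and a bijection $f:X_\ell\to V_X$, $\mathcal{T}$ consists of, for each $P\in\mathcal{Q}$ (arbitrarily oriented), the sequence of vertices of $P$ in $N_G[V_4]\cup V_X$ in order with each $v\in V_X$ replaced by $f^{ -1}(v)$, and $d(x_i)=\deg_G(f(x_i))$. Odd number of a pattern: an element $v\in N_G[V_4]$ (resp. $v\in X_\ell$) loses oddity if $\deg_G(v)$ (resp. $d(v)$) is odd and $\sum_{T\in\mathcal{T}}\deg_T(v)$ is odd; it gains oddity if $\deg_G(v)$ (resp. $d(v)$) is even and $\sum_{T\in\mathcal{T}}\deg_T(v)$ is odd. $\mathrm{odd}(\mathcal{T},d)$ is the number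 of elements of $N_G[V_4]\cup X_\ell$ gaining oddity minus the number losing oddity. -}

module Defs where

open import Data.Nat using (ℕ; zero; suc; _+_; _≤_; _≤ᵇ_; _≡ᵇ_; _%_)
open import Data.Integer as ℤ using (ℤ; +_; _-_)
open import Data.Bool using (Bool; true; false; _∧_; _∨_; not; if_then_else_; T)
open import Data.Fin as Fin using (Fin; _<_)
open import Data.List using (List; []; _∷_; length; map; allFin; filterᵇ; reverse; lookup)
open import Data.Bool.ListAction using (any)
open import Data.Nat.ListAction using (sum)
open import Data.List.Membership.Propositional using (_∈_)
open import Data.List.Relation.Unary.All using (All)
open import Data.List.Relation.Unary.AllPairs using (AllPairs)
open import Data.List.Relation.Unary.Linked using (Linked)
open import Data.List.Relation.Unary.Unique.Propositional using (Unique)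
open import Data.List.Relation.Binary.Pointwise using (Pointwise)
open import Data.Product using (Σ; ∃; _×_; _,_)
open import Data.Sum using (_⊎_; inj₁; inj₂)
open import Data.Sum.Properties as SumP using ()
open import Data.Empty using (⊥)
open import Data.Unit using (⊤)
open import Relation.Nullary using (¬_; does)
open import Relation.Binary.PropositionalEquality using (_≡_; _≢_; refl; cong; cong₂)
open import Data.Bool.Properties using (∨-comm)
open import Function.Definitions using (Injective)

countB : {A : Set} → (A → Bool) → List A → ℕ
countB p []       = 0
countB p (x ∷ xs) = (if p x then 1 else 0) + countB p xs

-- last element of the nonempty list x ∷ xs
lastOr : {A : Set} → A → List A → A
lastOr x []       = x
lastOr x (y ∷ ys) = lastOr y ys

pairs : {A : Set} → List A → List (A × A)
pairs []           = []
pairs (x ∷ [])     = []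
pairs (x ∷ y ∷ xs) = (x , y) ∷ pairs (y ∷ xs)

Consec : {A : Set} → A → A → List A → Set
Consec a b s = ((a , b) ∈ pairs s) ⊎ ((b , a) ∈ pairs s)

isOddB : ℕ → Bool
isOddB k = k % 2 ≡ᵇ 1

record Graph (n : ℕ) : Set where
  field
    adj    : Fin n → Fin n → Bool
    sym    : ∀ u v → adj u v ≡ adj v u
    irrefl : ∀ v → adj v v ≡ false
open Graph public

module _ {n : ℕ} (G : Graph n) where

  deg : Fin n → ℕ
  deg v = countB (adj G v) (allFin n)

  oddG : ℕ
  oddG = countB (λ v → isOddB (deg v)) (allFin n)

  inV4 : Fin n → Bool
  inV4 v = 4 ≤ᵇ deg v

  inNV4 : Fin n → Bool
  inNV4 v = inV4 v ∨ any (λ u → adj G v u ∧ inV4 u) (allFin n)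

  IsPath : List (Fin n) → Set
  IsPath P = Unique P × Linked (λ u v → T (adj G u v)) P × (2 ≤ length P)

  PathFromTo : List (Fin n) → Fin n → Fin n → Set
  PathFromTo [] u v = ⊥
  PathFromTo (x ∷ xs) u v = IsPath (x ∷ xs) × x ≡ u × lastOr x xs ≡ v

  Connected : Set
  Connected = ∀ u v → u ≡ v ⊎ Σ (List (Fin n)) (λ P → PathFromTo P u v)

  IsCycle : List (Fin n) → Set
  IsCycle [] = ⊥
  IsCycle (x ∷ xs) = Unique (x ∷ xs) × Linked (λ u v → T (adj G u v)) (x ∷ xs)
                     × T (adj G (lastOr x xs) x) × (3 ≤ length (x ∷ xs))

  deg3B : Fin n → Bool
  deg3B v = deg v ≡ᵇ 3

  CycleWith3s : ℕ → List (Fin n) → Set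
  CycleWith3s k C = IsCycle C × All (λ v → deg v ≡ 2 ⊎ deg v ≡ 3) C × countB deg3B C ≡ k

  IsPanCycle : List (Fin n) → Set
  IsPanCycle = CycleWith3s 1

  IsBullCycle : List (Fin n) → Set
  IsBullCycle = CycleWith3s 2

  Subcubic : Set
  Subcubic = ∀ v → deg v ≤ 3

  Nice : Set
  Nice = Connected × ¬ Subcubic × (∀ C → ¬ IsPanCycle C)
         × (∀ C → IsBullCycle C → length C ≡ 3)

eqF : {n : ℕ} → Fin n → Fin n → Bool
eqF a b = does (a Fin.≟ b)

onPathB : {n : ℕ} → Fin n → Fin n → List (Fin n) → Bool
onPathB u v []           = false
onPathB u v (x ∷ [])     = false
onPathB u v (x ∷ y ∷ xs) = (eqF u x ∧ eqF v y) ∨ onPathB u v (y ∷ xs)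

onFamilyB : {n : ℕ} → List (List (Fin n)) → Fin n → Fin n → Bool
onFamilyB Q u v = any (λ P → onPathB u v P ∨ onPathB v u P) Q

onFamily-sym : {n : ℕ} (Q : List (List (Fin n))) (u v : Fin n) → onFamilyB Q u v ≡ onFamilyB Q v u
onFamily-sym []      u v = refl
onFamily-sym (P ∷ Q) u v = cong₂ _∨_ (∨-comm (onPathB u v P) (onPathB v u P)) (onFamily-sym Q u v)

_−_ : {n : ℕ} → Graph n → List (List (Fin n)) → Graph n
adj    (G − Q) u v = adj G u v ∧ not (onFamilyB Q u v)
sym    (G − Q) u v = cong₂ _∧_ (sym G u v) (cong not (onFamily-sym Q u v))
irrefl (G − Q) v with adj G v v | irrefl G v
... | false | refl = refl

module _ {n : ℕ} (G : Graph n) where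

  EdgeDisjoint : List (Fin n) → List (Fin n) → Set
  EdgeDisjoint P P' = ∀ u v → Consec u v P → Consec u v P' → ⊥

  CoveringFamily : List (List (Fin n)) → Set
  CoveringFamily Q = All (IsPath G) Q × AllPairs EdgeDisjoint Q
    × (∀ u v → T (adj G u v) → T (inV4 G u) → Σ (List (Fin n)) λ P → P ∈ Q × Consec u v P)

  EndsIn : (Fin n → Bool) → List (Fin n) → Set
  EndsIn U []       = ⊤
  EndsIn U (x ∷ xs) = T (U x) × T (U (lastOr x xs))

  BetweenU : (Fin n → Bool) → List (Fin n) → Fin n → Fin n → Set
  BetweenU U P u v = Σ (Fin (length P)) λ i → Σ (Fin (length P)) λ j → Σ (Fin (length P)) λ k →
    lookup P i ≡ u × lookup P j ≡ v × T (U (lookup P k)) × ((i < k × k < j) ⊎ (j < k × k < i))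

  Separated : (Fin n → Bool) → List (Fin n) → List (Fin n) → Set
  Separated U P₁ P₂ = ∀ u v → T (U u) → T (U v) → u ≢ v →
    u ∈ P₁ → v ∈ P₁ → u ∈ P₂ → v ∈ P₂ → BetweenU U P₁ u v ⊎ BetweenU U P₂ u v

  TerminalCollection : (Fin n → Bool) → List (List (Fin n)) → Set
  TerminalCollection U Q = (∀ v → T (inNV4 G v) → T (U v)) × All (EndsIn U) Q
    × AllPairs (Separated U) Q

-- symbols: vertices (inj₁) or formal variables x_i (inj₂)
Sym : ℕ → ℕ → Set
Sym n ℓ = Fin n ⊎ Fin ℓ

Trace : ℕ → ℕ → Set
Trace n ℓ = List (Sym n ℓ)

eqS : {n ℓ : ℕ} → Sym n ℓ → Sym n ℓ → Bool
eqS a b = does (SumP.≡-dec Fin._≟_ Fin._≟_ a b)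

degT : {n ℓ : ℕ} → Sym n ℓ → Trace n ℓ → ℕ
degT y []       = 0
degT y (t ∷ ts) = if any (eqS y) (t ∷ ts)
                    then (if eqS y t ∨ eqS y (lastOr t ts) then 1 else 2)
                    else 0

sumDeg : {n ℓ : ℕ} → Sym n ℓ → List (Trace n ℓ) → ℕ
sumDeg y 𝒯 = sum (map (degT y) 𝒯)

isVarB : {n ℓ : ℕ} → Sym n ℓ → Bool
isVarB (inj₁ _) = false
isVarB (inj₂ _) = true

module _ {n : ℕ} (G : Graph n) (ℓ : ℕ) where

  isV4S : Sym n ℓ → Bool
  isV4S (inj₁ v) = inV4 G v
  isV4S (inj₂ _) = false

  ValidSym : Sym n ℓ → Set
  ValidSym (inj₁ v) = T (inNV4 G v)
  ValidSym (inj₂ _) = ⊤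

  NoVarNextToV4 : Sym n ℓ × Sym n ℓ → Set
  NoVarNextToV4 (a , b) = T (not ((isVarB a ∧ isV4S b) ∨ (isV4S a ∧ isVarB b)))

  IsTrace : Trace n ℓ → Set
  IsTrace t = All ValidSym t × Unique t × All NoVarNextToV4 (pairs t)

  EdgeOf : Trace n ℓ → Sym n ℓ → Sym n ℓ → Set
  EdgeOf t a b = Consec a b t × T (isV4S a ∨ isV4S b)

  EndOf : Trace n ℓ → Sym n ℓ → Sym n ℓ → Set
  EndOf t a b = Consec a b t × T (not (isV4S a ∨ isV4S b))

  DisjointTraces : Trace n ℓ → Trace n ℓ → Set
  DisjointTraces t t' = (∀ a b → EndOf t a b → EndOf t' a b → ⊥)
                      × (∀ a b → EdgeOf t a b → EdgeOf t' a b → ⊥)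

  inNopenV4 : Fin n → Bool
  inNopenV4 v = any (λ u → adj G v u ∧ inV4 G u) (allFin n)

  IsPattern : List (Trace n ℓ) → (Fin ℓ → ℕ) → Set
  IsPattern 𝒯 d =
      All IsTrace 𝒯
    × (∀ x → 1 ≤ d x × d x ≤ 3)
    × AllPairs DisjointTraces 𝒯
    × (∀ t → t ∈ 𝒯 → ∀ a b → EdgeOf t a b →
         Σ (Fin n) λ u → Σ (Fin n) λ v → a ≡ inj₁ u × b ≡ inj₁ v × T (adj G u v))
    × (∀ u v → T (adj G u v) → T (inV4 G u) →
         Σ (Trace n ℓ) λ t → t ∈ 𝒯 × EdgeOf t (inj₁ u) (inj₁ v))
    × (∀ x → sumDeg (inj₂ x) 𝒯 ≤ d x)
    × (∀ v → T (inNopenV4 v) → sumDeg (inj₁ v) 𝒯 ≤ deg G v)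

  -- symbol a stands for vertex w (variables via f)
  SymRel : (Fin ℓ → Fin n) → Sym n ℓ → Fin n → Set
  SymRel f (inj₁ v) w = v ≡ w × T (inNV4 G w)
  SymRel f (inj₂ x) w = f x ≡ w

  Encodes : List (Trace n ℓ) → (Fin ℓ → ℕ) → List (List (Fin n)) → Set
  Encodes 𝒯 d Q = Σ (Fin n → Bool) λ U → TerminalCollection G U Q ×
    Σ (Fin ℓ → Fin n) λ f →
        Injective _≡_ _≡_ f
      × (∀ x → T (U (f x)) × T (not (inNV4 G (f x))))
      × (∀ v → T (U v) → T (not (inNV4 G v)) → Σ (Fin ℓ) λ x → f x ≡ v)
      × Pointwise (λ t P → Pointwise (SymRel f) t (filterᵇ U P)
                          ⊎ Pointwise (SymRel f) t (reverse (filterᵇ U P))) 𝒯 Q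
      × (∀ x → d x ≡ deg G (f x))

  oddPat : List (Trace n ℓ) → (Fin ℓ → ℕ) → ℤ
  oddPat 𝒯 d = (+ gains) - (+ losses)
    where
      gains losses : ℕ
      gains  = countB (λ v → inNV4 G v ∧ not (isOddB (deg G v)) ∧ isOddB (sumDeg (inj₁ v) 𝒯)) (allFin n)
             + countB (λ x → not (isOddB (d x)) ∧ isOddB (sumDeg (inj₂ x) 𝒯)) (allFin ℓ)
      losses = countB (λ v → inNV4 G v ∧ isOddB (deg G v) ∧ isOddB (sumDeg (inj₁ v) 𝒯)) (allFin n)
             + countB (λ x → isOddB (d x) ∧ isOddB (sumDeg (inj₂ x) 𝒯)) (allFin ℓ)

module Submission where

-- Deleting the edges of the edge-disjoint paths Q lowers deg v by the number of path edges at v,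
-- which is odd exactly when v is an end of an odd number of paths; call this parity E v.
-- So odd(G − Q) counts the vertices with (deg v odd) xor E v.  On the pattern side, deg_T y is odd
-- exactly when y is an end of T, and the ends of a trace are those of the path it encodes, because
-- terminal collections contain all path ends.  Hence the total trace degree of a symbol has parity
-- E of the vertex it names, and every vertex with E odd lies in U, so it is either in N[V₄] or
-- named by a variable: gains and losses count exactly the vertices whose oddity E flips.

open import Defs hiding (sym)
open import Data.Fin as Fin using (Fin)
open import Data.List using (List)
open import Data.Nat using (ℕ)
open import Data.Product using (_,_)
open import Relation.Binary.PropositionalEquality

-- A separate module, so that ℕ's _+_ used throughout does not clash with ℤ's _+_ in the statement.
module Parity where

  open import Data.Bool using (Bool; true; false; _∧_; _∨_; not; _xor_; if_then_else_; T)
  open import Data.List using ([]; _∷_; _∷ʳ_; map; allFin; tabulate; reverse; filterᵇ)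
  open import Data.List.Relation.Unary.All using (All; []; _∷_; lookupWith)
  open import Data.List.Relation.Unary.AllPairs using (AllPairs; []; _∷_)
  open import Data.Nat using (zero; suc; _+_; s≤s)
  open import Data.Nat.Properties using (+-suc; +-identityʳ; +-commutativeSemigroup)
  open import Algebra.Properties.CommutativeSemigroup +-commutativeSemigroup
    using () renaming (interchange to +-interchange)
  open import Data.Bool.Properties
    using (T-≡; T-∨; ∨-comm; ∧-zeroʳ; ∧-identityʳ; ∧-comm; ∧-distribˡ-∨; not-distribˡ-xor;
           xor-assoc; xor-same)
  open import Data.Bool.ListAction using (any)
  open import Data.List.Properties using (unfold-reverse)
  open import Data.List.Relation.Unary.Any as Any using (Any; here; there)
  open import Data.List.Relation.Unary.Any.Properties using (any⁺; any⁻)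
  open import Data.List.Relation.Unary.All.Properties using (All¬⇒¬Any)
  open import Data.List.Relation.Unary.Linked using (Linked; _∷_)
  open import Data.List.Relation.Unary.Unique.Propositional using (Unique)
  import Data.List.Relation.Unary.Unique.Propositional.Properties as Unique
  open import Data.List.Relation.Binary.Pointwise using (Pointwise; []; _∷_)
  open import Data.List.Membership.Propositional using (_∈_; lose)
  open import Data.List.Membership.Propositional.Properties using (∈-allFin; ∈-map⁺; ∈-map⁻)
  open import Data.Product as Product using (∃; _×_; proj₁; proj₂)
  open import Data.Sum as Sum using (_⊎_; inj₁; inj₂)
  open import Data.Empty using (⊥; ⊥-elim)
  open import Data.Unit using (tt)
  open import Function using (_∘_)
  open import Function.Bundles using (Equivalence)
  open import Function.Definitions using (Injective)
  open import Relation.Nullary using (¬_; yes; no)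

  toℕ : Bool → ℕ
  toℕ b = if b then 1 else 0

  T-∧-projˡ : ∀ a {b} → T (a ∧ b) → T a
  T-∧-projˡ true _ = tt

  T-∧-projʳ : ∀ a {b} → T (a ∧ b) → T b
  T-∧-projʳ true b = b

  T-not⇒¬T : ∀ {b} → T (not b) → ¬ T b
  T-not⇒¬T {true} ()

  T-or-T-not : ∀ b → T b ⊎ T (not b)
  T-or-T-not true  = inj₁ tt
  T-or-T-not false = inj₂ tt

  xor-∧-disjoint : ∀ a b → T (a xor b) → T (a ∧ b) → ⊥
  xor-∧-disjoint true  true  ()
  xor-∧-disjoint true  false _  ()
  xor-∧-disjoint false b     _  ()

  not-∧-disjoint : ∀ a b → T a → T (not a ∧ b) → ⊥
  not-∧-disjoint true  b _  ()
  not-∧-disjoint false b () _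

  ∧-not-disjoint : ∀ a b → T (a ∧ not b) → T b → ⊥
  ∧-not-disjoint true  true  ()
  ∧-not-disjoint true  false _  ()
  ∧-not-disjoint false b     ()

  xor-disjoint : ∀ a b → (T a → T b → ⊥) → a xor b ≡ a ∨ b
  xor-disjoint true  true  a∧b = ⊥-elim (a∧b tt tt)
  xor-disjoint true  false _   = refl
  xor-disjoint false b     _   = refl

  xor-cancelʳ : ∀ a b → (a xor b) xor b ≡ a
  xor-cancelʳ true  true  = refl
  xor-cancelʳ true  false = refl
  xor-cancelʳ false true  = refl
  xor-cancelʳ false false = refl

  xor-cancel-middle : ∀ a b c → (a xor b) xor (b xor c) ≡ a xor c
  xor-cancel-middle a b c = begin
    (a xor b) xor (b xor c)   ≡⟨ xor-assoc a b (b xor c) ⟩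
    a xor (b xor (b xor c))   ≡⟨ cong (a xor_) (xor-assoc b b c) ⟨
    a xor ((b xor b) xor c)   ≡⟨ cong (λ e → a xor (e xor c)) (xor-same b) ⟩
    a xor c                   ∎
    where open ≡-Reasoning

  isOddB-suc : ∀ k → isOddB (suc k) ≡ not (isOddB k)
  isOddB-suc zero          = refl
  isOddB-suc (suc zero)    = refl
  isOddB-suc (suc (suc k)) = isOddB-suc k

  isOddB-+ : ∀ m n → isOddB (m + n) ≡ isOddB m xor isOddB n
  isOddB-+ zero    n = refl
  isOddB-+ (suc m) n = begin
    isOddB (suc (m + n))          ≡⟨ isOddB-suc (m + n) ⟩
    not (isOddB (m + n))          ≡⟨ cong not (isOddB-+ m n) ⟩
    not (isOddB m xor isOddB n)   ≡⟨ not-distribˡ-xor (isOddB m) (isOddB n) ⟩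
    not (isOddB m) xor isOddB n   ≡⟨ cong (_xor isOddB n) (isOddB-suc m) ⟨
    isOddB (suc m) xor isOddB n   ∎
    where open ≡-Reasoning

  isOddB-toℕ : ∀ b → isOddB (toℕ b) ≡ b
  isOddB-toℕ true  = refl
  isOddB-toℕ false = refl

  module _ {A : Set} where

    countB-cong : {p q : A → Bool} (xs : List A) → (∀ x → p x ≡ q x) → countB p xs ≡ countB q xs
    countB-cong []       p≗q = refl
    countB-cong (x ∷ xs) p≗q = cong₂ (λ b c → toℕ b + c) (p≗q x) (countB-cong xs p≗q)

    countB-none : {p : A → Bool} (xs : List A) → (∀ x → p x ≡ false) → countB p xs ≡ 0
    countB-none []       p≗false = refl
    countB-none (x ∷ xs) p≗false rewrite p≗false x = countB-none xs p≗false

    countB-∨ : {p q : A → Bool} (xs : List A) → (∀ x → T (p x) → T (q x) → ⊥) →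
      countB (λ x → p x ∨ q x) xs ≡ countB p xs + countB q xs
    countB-∨         []       disjoint = refl
    countB-∨ {p} {q} (x ∷ xs) disjoint with p x | q x | disjoint x
    ... | true  | true  | p∧q = ⊥-elim (p∧q tt tt)
    ... | true  | false | _   = cong suc (countB-∨ xs disjoint)
    ... | false | true  | _   = trans (cong suc (countB-∨ xs disjoint)) (sym (+-suc (countB p xs) _))
    ... | false | false | _   = countB-∨ xs disjoint

    countB-odd⇒Any : (p : A → Bool) (xs : List A) → T (isOddB (countB p xs)) → Any (T ∘ p) xs
    countB-odd⇒Any p (x ∷ xs) odd with p x in p-x
    ... | true  = here (Equivalence.from T-≡ p-x)
    ... | false = there (countB-odd⇒Any p xs odd)

    countB-xor-balance : (o e : A → Bool) (xs : List A) →
        countB (λ x → o x xor e x) xs + countB (λ x → o x ∧ e x) xs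
      ≡ countB o xs + countB (λ x → not (o x) ∧ e x) xs
    countB-xor-balance o e xs = begin
      countB (λ x → o x xor e x) xs + countB (λ x → o x ∧ e x) xs
        ≡⟨ countB-∨ xs (λ x → xor-∧-disjoint (o x) (e x)) ⟨
      countB (λ x → (o x xor e x) ∨ (o x ∧ e x)) xs
        ≡⟨ countB-cong xs (λ x → same-union (o x) (e x)) ⟩
      countB (λ x → o x ∨ (not (o x) ∧ e x)) xs
        ≡⟨ countB-∨ xs (λ x → not-∧-disjoint (o x) (e x)) ⟩
      countB o xs + countB (λ x → not (o x) ∧ e x) xs ∎
      where
      open ≡-Reasoning
      same-union : ∀ a b → (a xor b) ∨ (a ∧ b) ≡ a ∨ (not a ∧ b)
      same-union true  true  = refl
      same-union true  false = refl
      same-union false true  = refl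
      same-union false false = refl

  countB-map : {A B : Set} (p : B → Bool) (f : A → B) (xs : List A) →
    countB p (map f xs) ≡ countB (p ∘ f) xs
  countB-map p f []       = refl
  countB-map p f (x ∷ xs) = cong (toℕ (p (f x)) +_) (countB-map p f xs)

  countB-tabulate : {A : Set} {n : ℕ} (p : A → Bool) (f : Fin n → A) →
    countB p (tabulate f) ≡ countB (p ∘ f) (allFin n)
  countB-tabulate {n = zero}  p f = refl
  countB-tabulate {n = suc n} p f = cong (toℕ (p (f Fin.zero)) +_)
    (trans (countB-tabulate p (f ∘ Fin.suc)) (sym (countB-tabulate (p ∘ f) Fin.suc)))

  countB-allFin-suc : {n : ℕ} (p : Fin (suc n) → Bool) →
    countB p (allFin (suc n)) ≡ toℕ (p Fin.zero) + countB (p ∘ Fin.suc) (allFin n)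
  countB-allFin-suc p = cong (toℕ (p Fin.zero) +_) (countB-tabulate p Fin.suc)

  module _ {n : ℕ} where

    eqF-refl : (a : Fin n) → eqF a a ≡ true
    eqF-refl a with a Fin.≟ a
    ... | yes _   = refl
    ... | no a≢a = ⊥-elim (a≢a refl)

    eqF-sound : {a b : Fin n} → T (eqF a b) → a ≡ b
    eqF-sound {a} {b} a=b with a Fin.≟ b
    ... | yes a≡b = a≡b

    eqF-≢ : {a b : Fin n} → a ≢ b → eqF a b ≡ false
    eqF-≢ {a} {b} a≢b with a Fin.≟ b
    ... | yes a≡b = ⊥-elim (a≢b a≡b)
    ... | no _    = refl

    eqF-injective : {m : ℕ} {f : Fin m → Fin n} → Injective _≡_ _≡_ f →
      (x y : Fin m) → eqF (f x) (f y) ≡ eqF x y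
    eqF-injective {f = f} f-inj x y with x Fin.≟ y
    ... | yes refl = eqF-refl (f x)
    ... | no x≢y   = eqF-≢ (x≢y ∘ f-inj)

    _∈ᵇ_ : Fin n → List (Fin n) → Bool
    v ∈ᵇ xs = any (eqF v) xs

    ∈ᵇ-complete : {v : Fin n} {xs : List (Fin n)} → v ∈ xs → T (v ∈ᵇ xs)
    ∈ᵇ-complete {v} = any⁺ (eqF v) ∘ Any.map (λ { refl → Equivalence.from T-≡ (eqF-refl v) })

    ∈ᵇ-sound : {v : Fin n} (xs : List (Fin n)) → T (v ∈ᵇ xs) → v ∈ xs
    ∈ᵇ-sound {v} xs = Any.map eqF-sound ∘ any⁻ (eqF v) xs

  countB-∧-eqF : {n : ℕ} (h : Fin n → Bool) (x : Fin n) →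
    countB (λ v → h v ∧ eqF v x) (allFin n) ≡ toℕ (h x)
  countB-∧-eqF {suc n} h Fin.zero = begin
    countB (λ v → h v ∧ eqF v Fin.zero) (allFin (suc n))
      ≡⟨ countB-allFin-suc (λ v → h v ∧ eqF v Fin.zero) ⟩
    toℕ (h Fin.zero ∧ true) + countB (λ v → h (Fin.suc v) ∧ false) (allFin n)
      ≡⟨ cong₂ (λ b c → toℕ b + c) (∧-identityʳ (h Fin.zero))
               (countB-none (allFin n) (λ v → ∧-zeroʳ (h (Fin.suc v)))) ⟩
    toℕ (h Fin.zero) + 0
      ≡⟨ +-identityʳ (toℕ (h Fin.zero)) ⟩
    toℕ (h Fin.zero) ∎
    where open ≡-Reasoning
  countB-∧-eqF {suc n} h (Fin.suc x) = begin
    countB (λ v → h v ∧ eqF v (Fin.suc x)) (allFin (suc n))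
      ≡⟨ countB-allFin-suc (λ v → h v ∧ eqF v (Fin.suc x)) ⟩
    toℕ (h Fin.zero ∧ false) + countB (λ v → h (Fin.suc v) ∧ eqF v x) (allFin n)
      ≡⟨ cong (λ b → toℕ b + countB (λ v → h (Fin.suc v) ∧ eqF v x) (allFin n))
              (∧-zeroʳ (h Fin.zero)) ⟩
    countB (λ v → h (Fin.suc v) ∧ eqF v x) (allFin n)
      ≡⟨ countB-∧-eqF (h ∘ Fin.suc) x ⟩
    toℕ (h (Fin.suc x)) ∎
    where open ≡-Reasoning

  countB-unique : {n : ℕ} (g : Fin n → Bool) (xs : List (Fin n)) → Unique xs →
    countB g xs ≡ countB (λ v → g v ∧ v ∈ᵇ xs) (allFin n)
  countB-unique {n} g []       []           = sym (countB-none (allFin n) (λ v → ∧-zeroʳ (g v)))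
  countB-unique {n} g (x ∷ xs) (x∉xs ∷ xs!) = begin
    toℕ (g x) + countB g xs
      ≡⟨ cong₂ _+_ (sym (countB-∧-eqF g x)) (countB-unique g xs xs!) ⟩
    countB (λ v → g v ∧ eqF v x) (allFin n) + countB (λ v → g v ∧ v ∈ᵇ xs) (allFin n)
      ≡⟨ countB-∨ (allFin n) x-fresh ⟨
    countB (λ v → (g v ∧ eqF v x) ∨ (g v ∧ v ∈ᵇ xs)) (allFin n)
      ≡⟨ countB-cong (allFin n) (λ v → ∧-distribˡ-∨ (g v) (eqF v x) (v ∈ᵇ xs)) ⟨
    countB (λ v → g v ∧ v ∈ᵇ (x ∷ xs)) (allFin n) ∎
    where
    open ≡-Reasoning
    x-fresh : ∀ v → T (g v ∧ eqF v x) → T (g v ∧ v ∈ᵇ xs) → ⊥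
    x-fresh v v=x v∈xs = All¬⇒¬Any x∉xs
      (subst (_∈ xs) (eqF-sound {a = v} (T-∧-projʳ (g v) v=x)) (∈ᵇ-sound xs (T-∧-projʳ (g v) v∈xs)))

  countB-image : {n ℓ : ℕ} (g h : Fin n → Bool) (f : Fin ℓ → Fin n) → Injective _≡_ _≡_ f →
    (∀ x → ¬ T (g (f x))) → (∀ v → T (h v) → T (g v) ⊎ ∃ λ x → f x ≡ v) →
    countB (λ v → g v ∧ h v) (allFin n) + countB (h ∘ f) (allFin ℓ) ≡ countB h (allFin n)
  countB-image {n} {ℓ} g h f f-inj g∘f-false covered = begin
    countB (λ v → g v ∧ h v) (allFin n) + countB (h ∘ f) (allFin ℓ)
      ≡⟨ cong (countB (λ v → g v ∧ h v) (allFin n) +_) image-count ⟩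
    countB (λ v → g v ∧ h v) (allFin n) + countB (λ v → h v ∧ inImage v) (allFin n)
      ≡⟨ countB-∨ (allFin n) disjoint ⟨
    countB (λ v → (g v ∧ h v) ∨ (h v ∧ inImage v)) (allFin n)
      ≡⟨ countB-cong (allFin n) union ⟩
    countB h (allFin n) ∎
    where
    open ≡-Reasoning
    inImage : Fin n → Bool
    inImage v = v ∈ᵇ map f (allFin ℓ)

    image-count : countB (h ∘ f) (allFin ℓ) ≡ countB (λ v → h v ∧ inImage v) (allFin n)
    image-count = trans (sym (countB-map h f (allFin ℓ)))
      (countB-unique h (map f (allFin ℓ)) (Unique.map⁺ f-inj (Unique.allFin⁺ ℓ)))

    disjoint : ∀ v → T (g v ∧ h v) → T (h v ∧ inImage v) → ⊥
    disjoint v gv∧hv hv∧fv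
      with ∈-map⁻ f (∈ᵇ-sound {v = v} (map f (allFin ℓ)) (T-∧-projʳ (h v) hv∧fv))
    ... | x , _ , refl = g∘f-false x (T-∧-projˡ (g v) gv∧hv)

    union : ∀ v → (g v ∧ h v) ∨ (h v ∧ inImage v) ≡ h v
    union v with g v in g-v | h v in h-v
    ... | true  | true  = refl
    ... | true  | false = refl
    ... | false | false = refl
    ... | false | true with covered v (Equivalence.from T-≡ h-v)
    ...   | inj₁ g-v-true   = ⊥-elim (subst T g-v g-v-true)
    ...   | inj₂ (x , refl) = Equivalence.to T-≡ (∈ᵇ-complete (∈-map⁺ f (∈-allFin x)))

  module _ {A : Set} where

    lastOr-∈ : (x : A) (xs : List A) → lastOr x xs ∈ x ∷ xs
    lastOr-∈ x []       = here refl
    lastOr-∈ x (y ∷ ys) = there (lastOr-∈ y ys)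

    pairs-∈ : {a b : A} (L : List A) → (a , b) ∈ pairs L → a ∈ L × b ∈ L
    pairs-∈ (x ∷ y ∷ xs) (here refl) = here refl , there (here refl)
    pairs-∈ (x ∷ y ∷ xs) (there ab∈) = Product.map there there (pairs-∈ (y ∷ xs) ab∈)

    pairs-Linked : {R : A → A → Set} {a b : A} {L : List A} → Linked R L → (a , b) ∈ pairs L → R a b
    pairs-Linked (r ∷ rs) (here refl) = r
    pairs-Linked (r ∷ rs) (there ab∈) = pairs-Linked rs ab∈

    pairs-asym : {a b : A} (L : List A) → Unique L → (a , b) ∈ pairs L → ¬ (b , a) ∈ pairs L
    pairs-asym (x ∷ y ∷ xs) ((x≢y ∷ _) ∷ _) (here refl) (here refl) = x≢y refl
    pairs-asym (x ∷ y ∷ xs) (x∉ ∷ _)        (here refl) (there yx∈) =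
      All¬⇒¬Any x∉ (proj₂ (pairs-∈ (y ∷ xs) yx∈))
    pairs-asym (x ∷ y ∷ xs) (x∉ ∷ _)        (there xy∈) (here refl) =
      All¬⇒¬Any x∉ (proj₂ (pairs-∈ (y ∷ xs) xy∈))
    pairs-asym (x ∷ y ∷ xs) (_ ∷ y∷xs!)     (there ab∈) (there ba∈) =
      pairs-asym (y ∷ xs) y∷xs! ab∈ ba∈

    anyEnd : (A → Bool) → List A → Bool
    anyEnd p []       = false
    anyEnd p (a ∷ as) = p a ∨ p (lastOr a as)

    anyEnd⇒any : (p : A → Bool) (xs : List A) → T (anyEnd p xs) → T (any p xs)
    anyEnd⇒any p (a ∷ as) at-end =
      any⁺ {xs = a ∷ as} p (Sum.[ here , lose (lastOr-∈ a as) ]′ (Equivalence.to (T-∨ {p a}) at-end))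

    lastOr-∷ʳ : (x : A) (xs : List A) (z : A) → lastOr x (xs ∷ʳ z) ≡ z
    lastOr-∷ʳ x []       z = refl
    lastOr-∷ʳ x (y ∷ ys) z = lastOr-∷ʳ y ys z

    reverse-∷ : (x : A) (xs : List A) →
      ∃ λ ys → reverse (x ∷ xs) ≡ lastOr x xs ∷ ys × lastOr (lastOr x xs) ys ≡ x
    reverse-∷ x []       = [] , refl , refl
    reverse-∷ x (y ∷ ys) with reverse-∷ y ys
    ... | zs , rev≡ , _ =
      zs ∷ʳ x , trans (unfold-reverse x (y ∷ ys)) (cong (_∷ʳ x) rev≡) , lastOr-∷ʳ _ zs x

    anyEnd-reverse : (p : A → Bool) (xs : List A) → anyEnd p (reverse xs) ≡ anyEnd p xs
    anyEnd-reverse p []       = refl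
    anyEnd-reverse p (x ∷ xs) with reverse-∷ x xs
    ... | ys , rev≡ , last≡ rewrite rev≡ | last≡ = ∨-comm (p (lastOr x xs)) (p x)

    lastOr-filterᵇ : (U : A → Bool) (x : A) (xs : List A) → T (U (lastOr x xs)) →
      lastOr x (filterᵇ U xs) ≡ lastOr x xs
    lastOr-filterᵇ U x []       _      = refl
    lastOr-filterᵇ U x (y ∷ ys) U-last with U y in U-y
    ... | true = lastOr-filterᵇ U y ys U-last
    lastOr-filterᵇ U x (y ∷ [])     U-last | false = ⊥-elim (subst T U-y U-last)
    lastOr-filterᵇ U x (y ∷ z ∷ zs) U-last | false = lastOr-filterᵇ U x (z ∷ zs) U-last

    anyEnd-filterᵇ : (p U : A → Bool) (x : A) (xs : List A) → T (U x) → T (U (lastOr x xs)) →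
      anyEnd p (filterᵇ U (x ∷ xs)) ≡ anyEnd p (x ∷ xs)
    anyEnd-filterᵇ p U x xs U-x U-last with U x
    ... | true = cong (λ y → p x ∨ p y) (lastOr-filterᵇ U x xs U-last)

  module _ {A B : Set} {R : A → B → Set} {p : A → Bool} {q : B → Bool}
           (p≡q : ∀ {a b} → R a b → p a ≡ q b) where

    lastOr-Pointwise : (a : A) (as : List A) (b : B) (bs : List B) →
      R a b → Pointwise R as bs → R (lastOr a as) (lastOr b bs)
    lastOr-Pointwise a []        b []        r []        = r
    lastOr-Pointwise a (a′ ∷ as) b (b′ ∷ bs) _ (r′ ∷ rs) = lastOr-Pointwise a′ as b′ bs r′ rs

    anyEnd-Pointwise : {as : List A} {bs : List B} → Pointwise R as bs → anyEnd p as ≡ anyEnd q bs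
    anyEnd-Pointwise                   []       = refl
    anyEnd-Pointwise {a ∷ as} {b ∷ bs} (r ∷ rs) =
      cong₂ _∨_ (p≡q r) (p≡q (lastOr-Pointwise a as b bs r rs))

  module _ {n : ℕ} where

    onPathB-∷ : {u w x y : Fin n} (xs : List (Fin n)) → T (onPathB u w (x ∷ y ∷ xs)) →
      (u ≡ x × w ≡ y) ⊎ T (onPathB u w (y ∷ xs))
    onPathB-∷ {u} {w} {x} {y} xs uw∈ = Sum.map₁
      (λ uw=xy → eqF-sound (T-∧-projˡ (eqF u x) uw=xy) , eqF-sound (T-∧-projʳ (eqF u x) uw=xy))
      (Equivalence.to (T-∨ {eqF u x ∧ eqF w y}) uw∈)

    onPathB-pairs : {u w : Fin n} (L : List (Fin n)) → T (onPathB u w L) → (u , w) ∈ pairs L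
    onPathB-pairs (x ∷ y ∷ xs) uw∈ =
      Sum.[ (λ { (refl , refl) → here refl }) , there ∘ onPathB-pairs (y ∷ xs) ] (onPathB-∷ xs uw∈)

    onPathB-∈ : {u w : Fin n} (L : List (Fin n)) → T (onPathB u w L) → u ∈ L × w ∈ L
    onPathB-∈ L = pairs-∈ L ∘ onPathB-pairs L

    edgeOnB : List (Fin n) → Fin n → Fin n → Bool
    edgeOnB P u v = onPathB u v P ∨ onPathB v u P

    edgeOnB-Consec : (P : List (Fin n)) {u v : Fin n} → T (edgeOnB P u v) → Consec u v P
    edgeOnB-Consec P {u} {v} uv∈ =
      Sum.map (onPathB-pairs P) (onPathB-pairs P) (Equivalence.to (T-∨ {onPathB u v P}) uv∈)

    pathDegree outDegree inDegree : List (Fin n) → Fin n → ℕ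
    pathDegree P v = countB (edgeOnB P v) (allFin n)
    outDegree  P v = countB (λ u → onPathB v u P) (allFin n)
    inDegree   P v = countB (λ u → onPathB u v P) (allFin n)

    pathDegree≡out+in : (P : List (Fin n)) → Unique P → (v : Fin n) →
      pathDegree P v ≡ outDegree P v + inDegree P v
    pathDegree≡out+in P P! v =
      countB-∨ (allFin n) (λ u vu∈ uv∈ → pairs-asym P P! (onPathB-pairs P vu∈) (onPathB-pairs P uv∈))

    outDegree-∷ : (x y : Fin n) (ys : List (Fin n)) → Unique (x ∷ y ∷ ys) → (v : Fin n) →
      outDegree (x ∷ y ∷ ys) v ≡ toℕ (eqF v x) + outDegree (y ∷ ys) v
    outDegree-∷ x y ys (x∉ ∷ _) v = trans (countB-∨ (allFin n) x-not-later)
      (cong (_+ outDegree (y ∷ ys) v) (countB-∧-eqF (λ _ → eqF v x) y))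
      where
      x-not-later : ∀ u → T (eqF v x ∧ eqF u y) → T (onPathB v u (y ∷ ys)) → ⊥
      x-not-later u v=x∧u=y vu∈ = All¬⇒¬Any x∉ (subst (_∈ y ∷ ys)
        (eqF-sound (T-∧-projˡ (eqF v x) v=x∧u=y)) (proj₁ (onPathB-∈ (y ∷ ys) vu∈)))

    inDegree-∷ : (x y : Fin n) (ys : List (Fin n)) → Unique (x ∷ y ∷ ys) → (v : Fin n) →
      inDegree (x ∷ y ∷ ys) v ≡ toℕ (eqF v y) + inDegree (y ∷ ys) v
    inDegree-∷ x y ys (x∉ ∷ _) v = trans (countB-∨ (allFin n) x-not-later)
      (cong (_+ inDegree (y ∷ ys) v)
        (trans (countB-cong (allFin n) (λ u → ∧-comm (eqF u x) (eqF v y)))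
               (countB-∧-eqF (λ _ → eqF v y) x)))
      where
      x-not-later : ∀ u → T (eqF u x ∧ eqF v y) → T (onPathB u v (y ∷ ys)) → ⊥
      x-not-later u u=x∧v=y uv∈ = All¬⇒¬Any x∉ (subst (_∈ y ∷ ys)
        (eqF-sound (T-∧-projˡ (eqF u x) u=x∧v=y)) (proj₁ (onPathB-∈ (y ∷ ys) uv∈)))

    out+inDegree-parity : (x : Fin n) (xs : List (Fin n)) → Unique (x ∷ xs) → (v : Fin n) →
      isOddB (outDegree (x ∷ xs) v + inDegree (x ∷ xs) v) ≡ eqF v x xor eqF v (lastOr x xs)
    out+inDegree-parity x [] _ v = begin
      isOddB (countB (λ _ → false) (allFin n) + countB (λ _ → false) (allFin n))
        ≡⟨ cong isOddB (cong₂ _+_ no-edges no-edges) ⟩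
      false
        ≡⟨ xor-same (eqF v x) ⟨
      eqF v x xor eqF v x ∎
      where
      open ≡-Reasoning
      no-edges : countB (λ _ → false) (allFin n) ≡ 0
      no-edges = countB-none (allFin n) (λ _ → refl)
    out+inDegree-parity x (y ∷ ys) x∷y∷ys!@(_ ∷ y∷ys!) v = begin
      isOddB (outDegree (x ∷ y ∷ ys) v + inDegree (x ∷ y ∷ ys) v)
        ≡⟨ cong isOddB (cong₂ _+_ (outDegree-∷ x y ys x∷y∷ys! v) (inDegree-∷ x y ys x∷y∷ys! v)) ⟩
      isOddB ((toℕ (eqF v x) + outDegree (y ∷ ys) v) + (toℕ (eqF v y) + inDegree (y ∷ ys) v))
        ≡⟨ cong isOddB (+-interchange (toℕ (eqF v x)) _ (toℕ (eqF v y)) _) ⟩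
      isOddB ((toℕ (eqF v x) + toℕ (eqF v y)) + (outDegree (y ∷ ys) v + inDegree (y ∷ ys) v))
        ≡⟨ isOddB-+ (toℕ (eqF v x) + toℕ (eqF v y)) _ ⟩
      isOddB (toℕ (eqF v x) + toℕ (eqF v y)) xor isOddB (outDegree (y ∷ ys) v + inDegree (y ∷ ys) v)
        ≡⟨ cong₂ _xor_ (trans (isOddB-+ (toℕ (eqF v x)) _)
                              (cong₂ _xor_ (isOddB-toℕ (eqF v x)) (isOddB-toℕ (eqF v y))))
                       (out+inDegree-parity y ys y∷ys! v) ⟩
      (eqF v x xor eqF v y) xor (eqF v y xor eqF v (lastOr y ys))
        ≡⟨ xor-cancel-middle (eqF v x) (eqF v y) _ ⟩
      eqF v x xor eqF v (lastOr y ys) ∎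
      where open ≡-Reasoning

    endCount : Fin n → List (List (Fin n)) → ℕ
    endCount v Q = countB (anyEnd (eqF v)) Q

    familyDegree : List (List (Fin n)) → Fin n → ℕ
    familyDegree Q v = countB (onFamilyB Q v) (allFin n)

  module _ {n : ℕ} (G : Graph n) where

    pathDegree-parity : (P : List (Fin n)) → IsPath G P → (v : Fin n) →
      isOddB (pathDegree P v) ≡ anyEnd (eqF v) P
    pathDegree-parity (x ∷ [])     (_ , _ , s≤s ()) v
    pathDegree-parity (x ∷ y ∷ ys) (P!@(x∉ ∷ _) , _) v = begin
      isOddB (pathDegree P v)                  ≡⟨ cong isOddB (pathDegree≡out+in P P! v) ⟩
      isOddB (outDegree P v + inDegree P v)    ≡⟨ out+inDegree-parity x (y ∷ ys) P! v ⟩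
      eqF v x xor eqF v (lastOr y ys)          ≡⟨ xor-disjoint (eqF v x) _ ends-distinct ⟩
      eqF v x ∨ eqF v (lastOr y ys)            ∎
      where
      open ≡-Reasoning
      P = x ∷ y ∷ ys
      ends-distinct : T (eqF v x) → T (eqF v (lastOr y ys)) → ⊥
      ends-distinct v=x v=last = All¬⇒¬Any x∉
        (subst (_∈ y ∷ ys) (trans (sym (eqF-sound {a = v} v=last)) (eqF-sound v=x)) (lastOr-∈ y ys))

    onFamilyB-adj : (Q : List (List (Fin n))) → All (IsPath G) Q → {u v : Fin n} →
      T (onFamilyB Q u v) → T (adj G u v)
    onFamilyB-adj Q paths {u} {v} uv∈Q = lookupWith on-path paths (any⁻ (λ P → edgeOnB P u v) Q uv∈Q)
      where
      on-path : ∀ {P} → IsPath G P → T (edgeOnB P u v) → T (adj G u v)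
      on-path {P} (_ , linked , _) uv∈ with edgeOnB-Consec P uv∈
      ... | inj₁ uv∈pairs = pairs-Linked linked uv∈pairs
      ... | inj₂ vu∈pairs = subst T (Graph.sym G v u) (pairs-Linked linked vu∈pairs)

    familyDegree-parity : (Q : List (List (Fin n))) → All (IsPath G) Q → AllPairs (EdgeDisjoint G) Q →
      (v : Fin n) → isOddB (familyDegree Q v) ≡ isOddB (endCount v Q)
    familyDegree-parity []      []             []                v =
      cong isOddB (countB-none (allFin n) (λ _ → refl))
    familyDegree-parity (P ∷ Q) (path ∷ paths) (P-disj ∷ Q-disj) v = begin
      isOddB (familyDegree (P ∷ Q) v)
        ≡⟨ cong isOddB (countB-∨ {p = edgeOnB P v} {q = onFamilyB Q v} (allFin n) not-elsewhere) ⟩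
      isOddB (pathDegree P v + familyDegree Q v)
        ≡⟨ isOddB-+ (pathDegree P v) (familyDegree Q v) ⟩
      isOddB (pathDegree P v) xor isOddB (familyDegree Q v)
        ≡⟨ cong₂ _xor_ (trans (pathDegree-parity P path v) (sym (isOddB-toℕ _)))
                       (familyDegree-parity Q paths Q-disj v) ⟩
      isOddB (toℕ (anyEnd (eqF v) P)) xor isOddB (endCount v Q)
        ≡⟨ isOddB-+ (toℕ (anyEnd (eqF v) P)) (endCount v Q) ⟨
      isOddB (endCount v (P ∷ Q)) ∎
      where
      open ≡-Reasoning
      not-elsewhere : ∀ u → T (edgeOnB P v u) → T (onFamilyB Q v u) → ⊥
      not-elsewhere u vu∈P vu∈Q = lookupWith
        (λ P-disj-P′ vu∈P′ → P-disj-P′ v u (edgeOnB-Consec P vu∈P) (edgeOnB-Consec _ vu∈P′))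
        P-disj (any⁻ (λ P′ → edgeOnB P′ v u) Q vu∈Q)

    deg-−+familyDegree≡deg : (Q : List (List (Fin n))) → All (IsPath G) Q → (v : Fin n) →
      deg (G − Q) v + familyDegree Q v ≡ deg G v
    deg-−+familyDegree≡deg Q paths v = trans
      (sym (countB-∨ (allFin n) (λ u → ∧-not-disjoint (adj G v u) (onFamilyB Q v u))))
      (countB-cong (allFin n) kept-or-removed)
      where
      kept-or-removed : ∀ u → (adj G v u ∧ not (onFamilyB Q v u)) ∨ onFamilyB Q v u ≡ adj G v u
      kept-or-removed u with adj G v u | onFamilyB Q v u | onFamilyB-adj Q paths {v} {u}
      ... | true  | true  | _   = refl
      ... | true  | false | _   = refl
      ... | false | false | _   = refl
      ... | false | true  | v~u = ⊥-elim (v~u tt)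

    deg-−-parity : (Q : List (List (Fin n))) → All (IsPath G) Q → AllPairs (EdgeDisjoint G) Q →
      (v : Fin n) → isOddB (deg (G − Q) v) ≡ isOddB (deg G v) xor isOddB (endCount v Q)
    deg-−-parity Q paths disjoint v = begin
      isOddB (deg (G − Q) v)
        ≡⟨ xor-cancelʳ (isOddB (deg (G − Q) v)) (isOddB (familyDegree Q v)) ⟨
      (isOddB (deg (G − Q) v) xor isOddB (familyDegree Q v)) xor isOddB (familyDegree Q v)
        ≡⟨ cong₂ _xor_ (trans (sym (isOddB-+ (deg (G − Q) v) _))
                              (cong isOddB (deg-−+familyDegree≡deg Q paths v)))
                       (familyDegree-parity Q paths disjoint v) ⟩
      isOddB (deg G v) xor isOddB (endCount v Q) ∎
      where open ≡-Reasoning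

  degT-parity : {n ℓ : ℕ} (s : Sym n ℓ) (t : Trace n ℓ) → isOddB (degT s t) ≡ anyEnd (eqS s) t
  degT-parity s []       = refl
  degT-parity s (a ∷ as) with any (eqS s) (a ∷ as) | anyEnd (eqS s) (a ∷ as) | anyEnd⇒any (eqS s) (a ∷ as)
  ... | true  | true  | _       = refl
  ... | true  | false | _       = refl
  ... | false | false | _       = refl
  ... | false | true  | end⇒any = ⊥-elim (end⇒any tt)

  module _ {n ℓ : ℕ} (G : Graph n) (f : Fin ℓ → Fin n) (f-outside : ∀ x → T (not (inNV4 G (f x)))) where

    eqS-vertex : {v : Fin n} → T (inNV4 G v) → ∀ {a b} → SymRel G ℓ f a b → eqS (inj₁ v) a ≡ eqF v b
    eqS-vertex v-inside {inj₁ u} (refl , _) = refl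
    eqS-vertex v-inside {inj₂ y} refl =
      sym (eqF-≢ (λ v≡fy → T-not⇒¬T (f-outside y) (subst (T ∘ inNV4 G) v≡fy v-inside)))

    eqS-variable : Injective _≡_ _≡_ f → (x : Fin ℓ) →
      ∀ {a b} → SymRel G ℓ f a b → eqS (inj₂ x) a ≡ eqF (f x) b
    eqS-variable f-inj x {inj₁ u} (refl , u-inside) =
      sym (eqF-≢ (λ fx≡u → T-not⇒¬T (f-outside x) (subst (T ∘ inNV4 G) (sym fx≡u) u-inside)))
    eqS-variable f-inj x {inj₂ y} refl = sym (eqF-injective f-inj x y)

  module _ {n : ℕ} (G : Graph n) (U : Fin n → Bool) where

    endCount-odd⇒U : (Q : List (List (Fin n))) → All (EndsIn G U) Q → (v : Fin n) →
      T (isOddB (endCount v Q)) → T (U v)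
    endCount-odd⇒U Q ends v odd = lookupWith end-in-U ends (countB-odd⇒Any (anyEnd (eqF v)) Q odd)
      where
      end-in-U : ∀ {P} → EndsIn G U P → T (anyEnd (eqF v) P) → T (U v)
      end-in-U {x ∷ xs} (U-x , U-last) v-end with Equivalence.to (T-∨ {eqF v x}) v-end
      ... | inj₁ v=x    = subst (T ∘ U) (sym (eqF-sound v=x)) U-x
      ... | inj₂ v=last = subst (T ∘ U) (sym (eqF-sound v=last)) U-last

    module _ {ℓ : ℕ} (f : Fin ℓ → Fin n) where

      EncodesPath : Trace n ℓ → List (Fin n) → Set
      EncodesPath t P = Pointwise (SymRel G ℓ f) t (filterᵇ U P)
                      ⊎ Pointwise (SymRel G ℓ f) t (reverse (filterᵇ U P))

      module _ (s : Sym n ℓ) (w : Fin n) (s~w : ∀ {a b} → SymRel G ℓ f a b → eqS s a ≡ eqF w b) where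

        degT-encoded : (t : Trace n ℓ) (P : List (Fin n)) → EndsIn G U P → EncodesPath t P →
          isOddB (degT s t) ≡ anyEnd (eqF w) P
        degT-encoded t []       _              (inj₁ []) = refl
        degT-encoded t []       _              (inj₂ []) = refl
        degT-encoded t (x ∷ xs) (U-x , U-last) t~P       = trans (degT-parity s t) (same-ends t~P)
          where
          filtered-ends : anyEnd (eqF w) (filterᵇ U (x ∷ xs)) ≡ anyEnd (eqF w) (x ∷ xs)
          filtered-ends = anyEnd-filterᵇ (eqF w) U x xs U-x U-last

          same-ends : EncodesPath t (x ∷ xs) → anyEnd (eqS s) t ≡ anyEnd (eqF w) (x ∷ xs)
          same-ends (inj₁ t~P′) = trans (anyEnd-Pointwise s~w t~P′) filtered-ends
          same-ends (inj₂ t~Pᴿ) = trans (anyEnd-Pointwise s~w t~Pᴿ)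
            (trans (anyEnd-reverse (eqF w) (filterᵇ U (x ∷ xs))) filtered-ends)

        sumDeg-encoded : (𝒯 : List (Trace n ℓ)) (Q : List (List (Fin n))) → All (EndsIn G U) Q →
          Pointwise EncodesPath 𝒯 Q → isOddB (sumDeg s 𝒯) ≡ isOddB (endCount w Q)
        sumDeg-encoded []      []      []             []          = refl
        sumDeg-encoded (t ∷ 𝒯) (P ∷ Q) (ends ∷ endss) (t~P ∷ 𝒯~Q) = begin
          isOddB (degT s t + sumDeg s 𝒯)
            ≡⟨ isOddB-+ (degT s t) (sumDeg s 𝒯) ⟩
          isOddB (degT s t) xor isOddB (sumDeg s 𝒯)
            ≡⟨ cong₂ _xor_ (trans (degT-encoded t P ends t~P) (sym (isOddB-toℕ _)))
                           (sumDeg-encoded 𝒯 Q endss 𝒯~Q) ⟩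
          isOddB (toℕ (anyEnd (eqF w) P)) xor isOddB (endCount w Q)
            ≡⟨ isOddB-+ (toℕ (anyEnd (eqF w) P)) (endCount w Q) ⟨
          isOddB (endCount w (P ∷ Q)) ∎
          where open ≡-Reasoning

  module _ {n : ℕ} (G : Graph n) (ℓ : ℕ) (𝒯 : List (Trace n ℓ)) (d : Fin ℓ → ℕ) where

    -- The two counts inside oddPat, so that oddPat G ℓ 𝒯 d is + gains - + losses by definition.
    gains losses : ℕ
    gains  = countB (λ v → inNV4 G v ∧ not (isOddB (deg G v)) ∧ isOddB (sumDeg (inj₁ v) 𝒯)) (allFin n)
           + countB (λ x → not (isOddB (d x)) ∧ isOddB (sumDeg (inj₂ x) 𝒯)) (allFin ℓ)
    losses = countB (λ v → inNV4 G v ∧ isOddB (deg G v) ∧ isOddB (sumDeg (inj₁ v) 𝒯)) (allFin n)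
           + countB (λ x → isOddB (d x) ∧ isOddB (sumDeg (inj₂ x) 𝒯)) (allFin ℓ)

    oddSymbols≡oddEnds : (Q : List (List (Fin n))) → Encodes G ℓ 𝒯 d Q → (c : Bool → Bool) →
        countB (λ v → inNV4 G v ∧ c (isOddB (deg G v)) ∧ isOddB (sumDeg (inj₁ v) 𝒯)) (allFin n)
      + countB (λ x → c (isOddB (d x)) ∧ isOddB (sumDeg (inj₂ x) 𝒯)) (allFin ℓ)
      ≡ countB (λ v → c (isOddB (deg G v)) ∧ isOddB (endCount v Q)) (allFin n)
    oddSymbols≡oddEnds Q (U , (_ , ends , _) , f , f-inj , f-outside , f-onto , 𝒯~Q , d≡deg) c =
      trans (cong₂ _+_ (countB-cong (allFin n) vertex-term) (countB-cong (allFin ℓ) variable-term))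
            (countB-image (inNV4 G) h f f-inj (λ x → T-not⇒¬T (f-outside′ x)) covered)
      where
      f-outside′ : ∀ x → T (not (inNV4 G (f x)))
      f-outside′ = proj₂ ∘ f-outside

      h : Fin n → Bool
      h v = c (isOddB (deg G v)) ∧ isOddB (endCount v Q)

      vertex-term : ∀ v →
        inNV4 G v ∧ c (isOddB (deg G v)) ∧ isOddB (sumDeg (inj₁ v) 𝒯) ≡ inNV4 G v ∧ h v
      vertex-term v with inNV4 G v in v-inside
      ... | false = refl
      ... | true  = cong (c (isOddB (deg G v)) ∧_) (sumDeg-encoded G U f (inj₁ v) v
        (eqS-vertex G f f-outside′ (Equivalence.from T-≡ v-inside)) 𝒯 Q ends 𝒯~Q)

      variable-term : ∀ x → c (isOddB (d x)) ∧ isOddB (sumDeg (inj₂ x) 𝒯) ≡ h (f x)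
      variable-term x = cong₂ (λ k b → c (isOddB k) ∧ b) (d≡deg x) (sumDeg-encoded G U f (inj₂ x) (f x)
        (eqS-variable G f f-outside′ f-inj x) 𝒯 Q ends 𝒯~Q)

      covered : ∀ v → T (h v) → T (inNV4 G v) ⊎ ∃ λ x → f x ≡ v
      covered v h-v with T-or-T-not (inNV4 G v)
      ... | inj₁ inside  = inj₁ inside
      ... | inj₂ outside = inj₂ (f-onto v (endCount-odd⇒U G U Q ends v (T-∧-projʳ (c _) h-v)) outside)

    oddG-balance : (Q : List (List (Fin n))) → All (IsPath G) Q → AllPairs (EdgeDisjoint G) Q →
      Encodes G ℓ 𝒯 d Q → oddG (G − Q) + losses ≡ oddG G + gains
    oddG-balance Q paths disjoint encoding = begin
      oddG (G − Q) + losses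
        ≡⟨ cong₂ _+_ (countB-cong (allFin n) (deg-−-parity G Q paths disjoint))
                     (oddSymbols≡oddEnds Q encoding (λ b → b)) ⟩
      countB (λ v → o v xor E v) (allFin n) + countB (λ v → o v ∧ E v) (allFin n)
        ≡⟨ countB-xor-balance o E (allFin n) ⟩
      oddG G + countB (λ v → not (o v) ∧ E v) (allFin n)
        ≡⟨ cong (oddG G +_) (oddSymbols≡oddEnds Q encoding not) ⟨
      oddG G + gains ∎
      where
      open ≡-Reasoning
      o E : Fin n → Bool
      o v = isOddB (deg G v)
      E v = isOddB (endCount v Q)

open Parity using (gains; losses; oddG-balance)

open import Data.Integer as ℤ using (+_; _+_; _-_)
open import Data.Integer.Properties using (pos-+; +-assoc; +-inverseʳ; +-identityʳ)
import Data.Nat as ℕ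

pos-balance : ∀ a b g l → a ℕ.+ l ≡ b ℕ.+ g → + a ≡ + b + (+ g - + l)
pos-balance a b g l a+l≡b+g = sym (begin
  + b + (+ g - + l)        ≡⟨ +-assoc (+ b) (+ g) (ℤ.- + l) ⟨
  + b + + g - + l          ≡⟨ cong (_- + l) (pos-+ b g) ⟨
  + (b ℕ.+ g) - + l        ≡⟨ cong (λ k → + k - + l) a+l≡b+g ⟨
  + (a ℕ.+ l) - + l        ≡⟨ cong (_- + l) (pos-+ a l) ⟩
  + a + + l - + l          ≡⟨ +-assoc (+ a) (+ l) (ℤ.- + l) ⟩
  + a + (+ l - + l)        ≡⟨ cong (_+_ (+ a)) (+-inverseʳ (+ l)) ⟩
  + a + + 0                ≡⟨ +-identityʳ (+ a) ⟩
  + a                      ∎)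
  where open ≡-Reasoning

lemma20 : ∀ {n} (G : Graph n) → Nice G →
    (Q : List (List (Fin n))) → CoveringFamily G Q →
    (ℓ : ℕ) (𝒯 : List (Trace n ℓ)) (d : Fin ℓ → ℕ) →
    IsPattern G ℓ 𝒯 d → Encodes G ℓ 𝒯 d Q →
    + oddG (G − Q) ≡ + oddG G + oddPat G ℓ 𝒯 d
lemma20 G _ Q (paths , disjoint , _) ℓ 𝒯 d _ encoding =
  pos-balance _ _ (gains G ℓ 𝒯 d) (losses G ℓ 𝒯 d)
    (oddG-balance G ℓ 𝒯 d Q paths disjoint encoding)
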